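{- Let $\pi\in S_n$ be shallow. Then: (1) there do not exist indices $r<i<j<s$ with $\pi_i=n$, $\pi_j=1$ and $\pi_r>\pi_s$ (i.e. $\pi$ avoids the pattern $3412$ in which the "4" is the entry $n$ and the "1" is the entry $1$); and (2) there do not exist indices $1<i<j<n$ with $\pi_j<\pi_n<\pi_1<\pi_i$ (i.e. $\pi$ avoids the pattern $3412$ in which the "3" is $\pi_1$ and the "2" is $\pi_n$).
   Context: For $\pi=\pi_1\cdots\pi_n \in S_n$: $D(\pi)=\sum_{i=1}^n|\pi_i-i|$; $I(\pi)=|\{(i,j): i<j,\ \pi_i>\pi_j\}|$; $T(\pi)=n-\mathrm{cyc}(\pi)$ where $\mathrm{cyc}(\pi)$ is the number of cycles of $\pi$. $\pi$ is shallow if $I(\pi)+T(\pi)=D(\pi)$. -}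

module Defs where

open import Data.Nat.Base using (ℕ; zero; suc; _+_; _∸_; ∣_-_∣; _<ᵇ_; _≤ᵇ_)
open import Data.Bool.Base using (Bool; true; false; if_then_else_; _∧_)
open import Data.Fin.Base using (Fin; toℕ)
open import Data.Fin.Permutation using (Permutation′; _⟨$⟩ʳ_)
open import Data.List.Base using (List; []; _∷_; allFin; map; upTo)
open import Data.Nat.ListAction using (sum)
open import Relation.Binary.PropositionalEquality using (_≡_)

-- Permutations of {1,…,n} are modelled as bijections of Fin n = {0,…,n-1};
-- position i (0-based) has value π ⟨$⟩ʳ i.  Shifting positions and values
-- by one does not change D, I, T or the pattern conditions.

countᵇ : {A : Set} → (A → Bool) → List A → ℕ
countᵇ p [] = 0
countᵇ p (x ∷ xs) = (if p x then 1 else 0) + countᵇ p xs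

allᵇ : {A : Set} → (A → Bool) → List A → Bool
allᵇ p [] = true
allᵇ p (x ∷ xs) = p x ∧ allᵇ p xs

D : {n : ℕ} → Permutation′ n → ℕ
D {n} π = sum (map (λ i → ∣ toℕ (π ⟨$⟩ʳ i) - toℕ i ∣) (allFin n))

I : {n : ℕ} → Permutation′ n → ℕ
I {n} π = sum (map (λ i → countᵇ (λ j → (toℕ i <ᵇ toℕ j) ∧ (toℕ (π ⟨$⟩ʳ j) <ᵇ toℕ (π ⟨$⟩ʳ i))) (allFin n)) (allFin n))

iter : {n : ℕ} → Permutation′ n → ℕ → Fin n → Fin n
iter π zero i = i
iter π (suc k) i = π ⟨$⟩ʳ (iter π k i)

-- i is the least element of its cycle: i ≤ π^k(i) for all k < n
-- (the cycle of i is {π^k(i) : k < n}, as every cycle has length ≤ n)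
isCycleMin : {n : ℕ} → Permutation′ n → Fin n → Bool
isCycleMin {n} π i = allᵇ (λ k → toℕ i ≤ᵇ toℕ (iter π k i)) (upTo n)

cyc : {n : ℕ} → Permutation′ n → ℕ
cyc {n} π = countᵇ (isCycleMin π) (allFin n)

T : {n : ℕ} → Permutation′ n → ℕ
T {n} π = n ∸ cyc π

Shallow : {n : ℕ} → Permutation′ n → Set
Shallow π = I π + T π ≡ D π

-- The Diaconis–Graham inequality I(π) + T(π) ≤ D(π) holds for every π: unless π is the identity
-- there are positions a < b with π(b) ≤ a < b ≤ π(a), and swapping the values at a and b lowers D
-- by exactly 2(b − a), I by at most 2(b − a) − 1 and T by at most 1, so induction on D applies.
-- Hence such a swap keeps a shallow permutation shallow, and in a shallow permutation every value
-- strictly between the positions a and b lies between π(b) and π(a), since otherwise I would drop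
-- by at most 2(b − a) − 2.
--
-- For (1), take r < i < j < s with π(i) = n, π(j) = 1 and π(s) < π(r). If j ≤ π(r), the pair
-- (r, j) is such a pair with π(i) > π(r) in between; if π(s) ≤ i, the pair (i, s) is one with
-- π(j) < π(s) in between. Otherwise π(r) ∈ (i, j), so the cycle of r enters (i, j) and must leave
-- it again at some k ∈ (i, j). Swapping i and k (if π(k) ≤ i) or k and j (if π(k) ≥ j) gives a
-- shallow permutation with the same kind of pattern and j − i smaller. Since D, I and T are
-- invariant under inversion, (2) is (1) applied to π⁻¹.

module Submission where

open import Defs
open import Data.Nat.Base using (ℕ; _<_; _∸_)
open import Data.Fin.Base using (Fin; toℕ)
open import Data.Fin.Permutation using (Permutation′; _⟨$⟩ʳ_)
open import Data.Product using (_×_; ∃-syntax)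
open import Relation.Nullary using (¬_)
open import Relation.Binary.PropositionalEquality using (_≡_)

open import Data.Bool.Base using (Bool; true; false; if_then_else_; _∧_; not) renaming (T to IsTrue)
open import Data.Bool.ListAction using (all)
open import Data.Bool.Properties using (∧-comm; T-∧)
open import Data.Empty using (⊥; ⊥-elim)
open import Data.Fin.Base using (zero; suc)
open import Data.Fin.Permutation using (_⟨$⟩ˡ_; inverseˡ; inverseʳ; flip; transpose; _∘ₚ_)
import Data.Fin.Permutation.Components as PC
open import Data.Fin.Properties using (_≟_; pigeonhole; toℕ<n; toℕ-injective; toℕ≤pred[n])
import Data.Fin.Properties as Finₚ
open import Data.List.Base using (List; []; _∷_; tabulate; map; allFin; upTo)
open import Data.List.Relation.Unary.All using (All)
open import Data.List.Relation.Unary.All.Properties using (¬All⇒Any¬; applyUpTo⁺₁; applyUpTo⁻; all⁺; all⁻)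
import Data.List.Relation.Unary.Any.Properties as Any
open import Data.Nat.Base using (zero; suc; _+_; _*_; _≤_; _<ᵇ_; _≤ᵇ_; ∣_-_∣; z≤n; s≤s; s≤s⁻¹; s<s⁻¹)
open import Data.Nat.DivMod using (_%_; _/_; m%n<n; m≡m%n+[m/n]*n)
open import Data.Nat.Induction using (<-wellFounded)
import Data.Nat.ListAction as ListAction
open import Data.Nat.Properties hiding (_≟_)
open import Data.Product using (_,_; proj₁; proj₂)
open import Data.Sum using (_⊎_; inj₁; inj₂) renaming (map to map⊎; swap to swap⊎)
open import Function.Base using (_∘_)
open import Function.Bundles using (_⇔_; mk⇔; Equivalence)
open import Induction.WellFounded using (Acc; acc)
open import Relation.Binary.PropositionalEquality
  using (_≢_; refl; sym; trans; cong; cong₂; subst; ≢-sym; module ≡-Reasoning)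
open import Relation.Nullary using (Dec; does; contradiction; yes; no; _×-dec_)
open import Relation.Nullary.Decidable using (dec-true; dec-false; T?)
open import Relation.Unary using (Decidable)

open import Algebra.Properties.CommutativeMonoid.Sum +-0-commutativeMonoid
  using (sum; sum-syntax; sum-cong-≗; sum-replicate-zero; ∑-distrib-+; ∑-comm; sum-permute)
open import Algebra.Properties.CommutativeSemigroup +-commutativeSemigroup using (x∙yz≈y∙xz; xy∙z≈xz∙y)

-- Finite sums

𝟙 : Bool → ℕ
𝟙 b = if b then 1 else 0

𝟙-true : ∀ {b} → IsTrue b → 𝟙 b ≡ 1
𝟙-true {true} _ = refl

𝟙-false : ∀ {b} → ¬ IsTrue b → 𝟙 b ≡ 0
𝟙-false {false} _ = refl
𝟙-false {true} ¬b = contradiction _ ¬b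

𝟙-≤ : ∀ {b m} → (IsTrue b → 1 ≤ m) → 𝟙 b ≤ m
𝟙-≤ {false} _ = z≤n
𝟙-≤ {true} h = h _

𝟙-≤-+ : ∀ x y → 𝟙 x ≤ 𝟙 y + 𝟙 (x ∧ not y)
𝟙-≤-+ false y = z≤n
𝟙-≤-+ true false = ≤-refl
𝟙-≤-+ true true = ≤-refl

𝟙-∧-≤ˡ : ∀ x y → 𝟙 (x ∧ y) ≤ 𝟙 x
𝟙-∧-≤ˡ true y = 𝟙-≤ (λ _ → ≤-refl)
𝟙-∧-≤ˡ false y = z≤n

∧-<ᵇ⁺ : ∀ {m n k l} → m < n → k < l → IsTrue ((m <ᵇ n) ∧ (k <ᵇ l))
∧-<ᵇ⁺ m<n k<l = Equivalence.from T-∧ (<⇒<ᵇ m<n , <⇒<ᵇ k<l)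

∧-<ᵇ⁻ : ∀ {m n k l} → IsTrue ((m <ᵇ n) ∧ (k <ᵇ l)) → m < n × k < l
∧-<ᵇ⁻ {m} {n} {k} {l} t = let m<ᵇn , k<ᵇl = Equivalence.to T-∧ t in <ᵇ⇒< m n m<ᵇn , <ᵇ⇒< k l k<ᵇl

𝟙-∧ : ∀ {x y} → IsTrue x → IsTrue y → 𝟙 (x ∧ y) ≡ 1
𝟙-∧ tx ty = 𝟙-true (Equivalence.from T-∧ (tx , ty))

𝟙-∧-<ᵇ : ∀ {m n k l} → m < n → k < l → 𝟙 ((m <ᵇ n) ∧ (k <ᵇ l)) ≡ 1
𝟙-∧-<ᵇ m<n k<l = 𝟙-true (∧-<ᵇ⁺ m<n k<l)

𝟙-∧-<ˡ : ∀ {x y} → IsTrue x → ¬ IsTrue y → 𝟙 (x ∧ y) < 𝟙 x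
𝟙-∧-<ˡ {true} {false} _ _ = s≤s z≤n
𝟙-∧-<ˡ {true} {true} _ ¬y = contradiction _ ¬y

IsTrue-injective : ∀ {x y} → (IsTrue x → IsTrue y) → (IsTrue y → IsTrue x) → x ≡ y
IsTrue-injective {false} {false} _ _ = refl
IsTrue-injective {false} {true} _ y⇒x = ⊥-elim (y⇒x _)
IsTrue-injective {true} {false} x⇒y _ = ⊥-elim (x⇒y _)
IsTrue-injective {true} {true} _ _ = refl

IsTrue-not : ∀ {b} → IsTrue (not b) → ¬ IsTrue b
IsTrue-not {false} _ ()

allᵇ≡all : ∀ {A : Set} (p : A → Bool) xs → allᵇ p xs ≡ all p xs
allᵇ≡all p [] = refl
allᵇ≡all p (x ∷ xs) = cong (p x ∧_) (allᵇ≡all p xs)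

allᵇ⇔All : ∀ {A : Set} (p : A → Bool) xs → IsTrue (allᵇ p xs) ⇔ All (IsTrue ∘ p) xs
allᵇ⇔All p xs = mk⇔ (all⁺ p xs ∘ subst IsTrue (allᵇ≡all p xs)) (subst IsTrue (sym (allᵇ≡all p xs)) ∘ all⁻ p)

∑-zero : ∀ {n} {f : Fin n → ℕ} → (∀ i → f i ≡ 0) → sum f ≡ 0
∑-zero {n} f≡0 = trans (sum-cong-≗ f≡0) (sum-replicate-zero n)

∑-+-+ : ∀ {n} (f g h : Fin n → ℕ) → ∑[ i < n ] (f i + (g i + h i)) ≡ sum f + (sum g + sum h)
∑-+-+ f g h = trans (∑-distrib-+ f (λ i → g i + h i)) (cong (sum f +_) (∑-distrib-+ g h))

∑-1 : ∀ n → ∑[ i < n ] 1 ≡ n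
∑-1 zero = refl
∑-1 (suc n) = cong suc (∑-1 n)

∑-mono-≤ : ∀ {n} {f g : Fin n → ℕ} → (∀ i → f i ≤ g i) → sum f ≤ sum g
∑-mono-≤ {zero} _ = z≤n
∑-mono-≤ {suc n} f≤g = +-mono-≤ (f≤g zero) (∑-mono-≤ (f≤g ∘ suc))

∑-mono-< : ∀ {n} {f g : Fin n → ℕ} → (∀ i → f i ≤ g i) → ∀ k → f k < g k → sum f < sum g
∑-mono-< f≤g zero fk<gk = +-mono-<-≤ fk<gk (∑-mono-≤ (f≤g ∘ suc))
∑-mono-< f≤g (suc k) fk<gk = +-mono-≤-< (f≤g zero) (∑-mono-< (f≤g ∘ suc) k fk<gk)

∑-𝟙-≤1 : ∀ {n} (p : Fin n → Bool) → (∀ {x y} → IsTrue (p x) → IsTrue (p y) → x ≡ y) →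
         sum (𝟙 ∘ p) ≤ 1
∑-𝟙-≤1 {zero} p unique = z≤n
∑-𝟙-≤1 {suc n} p unique with p zero in p0
... | true = s≤s (≤-reflexive (∑-zero {f = 𝟙 ∘ p ∘ suc} λ x →
  𝟙-false λ px → Finₚ.0≢1+n (unique (subst IsTrue (sym p0) _) px)))
... | false = ∑-𝟙-≤1 (p ∘ suc) λ px py → Finₚ.suc-injective (unique px py)

_↦_ : ∀ {n} → Fin n → ℕ → Fin n → ℕ
(a ↦ c) x = if does (x ≟ a) then c else 0

↦-same : ∀ {n} (a : Fin n) c → (a ↦ c) a ≡ c
↦-same a c rewrite dec-true (a ≟ a) refl = refl

↦-other : ∀ {n} {a x : Fin n} c → x ≢ a → (a ↦ c) x ≡ 0
↦-other {a = a} {x} c x≢a rewrite dec-false (x ≟ a) x≢a = refl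

∑-↦ : ∀ {n} (a : Fin n) c → sum (a ↦ c) ≡ c
∑-↦ {suc n} zero c = trans (cong (c +_) (sum-replicate-zero n)) (+-identityʳ c)
∑-↦ {suc n} (suc a) c = ∑-↦ a c

∑-below : ∀ {n} hi → ∑[ q < n ] 𝟙 (toℕ q <ᵇ hi) ≤ hi
∑-below {zero} hi = z≤n
∑-below {suc n} zero = ≤-reflexive (sum-replicate-zero (suc n))
∑-below {suc n} (suc hi) = s≤s (∑-below {n} hi)

inRange : ℕ → ℕ → ℕ → Bool
inRange lo hi x = (x <ᵇ hi) ∧ (lo <ᵇ x)

inRange⁺ : ∀ {lo hi x} → lo < x → x < hi → IsTrue (inRange lo hi x)
inRange⁺ lo<x x<hi = ∧-<ᵇ⁺ x<hi lo<x

∑-inRange : ∀ {n} lo hi → ∑[ q < n ] 𝟙 (inRange lo hi (toℕ q)) ≤ hi ∸ suc lo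
∑-inRange {zero} lo hi = z≤n
∑-inRange {suc n} lo zero = ≤-reflexive (sum-replicate-zero (suc n))
∑-inRange {suc n} zero (suc hi) = ≤-trans (∑-mono-≤ {n} λ q → 𝟙-∧-≤ˡ (toℕ q <ᵇ hi) true) (∑-below {n} hi)
∑-inRange {suc n} (suc lo) (suc hi) = ∑-inRange {n} lo hi

sum-map-tabulate : ∀ {A : Set} {n} (f : A → ℕ) (g : Fin n → A) →
                   ListAction.sum (map f (tabulate g)) ≡ ∑[ i < n ] f (g i)
sum-map-tabulate {n = zero} f g = refl
sum-map-tabulate {n = suc n} f g = cong (f (g zero) +_) (sum-map-tabulate f (g ∘ suc))

countᵇ-tabulate : ∀ {A : Set} {n} (p : A → Bool) (g : Fin n → A) →
                  countᵇ p (tabulate g) ≡ ∑[ i < n ] 𝟙 (p (g i))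
countᵇ-tabulate {n = zero} p g = refl
countᵇ-tabulate {n = suc n} p g = cong (𝟙 (p (g zero)) +_) (countᵇ-tabulate p (g ∘ suc))

module _ {n : ℕ} (π : Permutation′ n) where

  inversion : Fin n → Fin n → Bool
  inversion i j = (toℕ i <ᵇ toℕ j) ∧ (toℕ (π ⟨$⟩ʳ j) <ᵇ toℕ (π ⟨$⟩ʳ i))

  D-∑ : D π ≡ ∑[ i < n ] ∣ toℕ (π ⟨$⟩ʳ i) - toℕ i ∣
  D-∑ = sum-map-tabulate (λ i → ∣ toℕ (π ⟨$⟩ʳ i) - toℕ i ∣) (λ i → i)

  I-∑ : I π ≡ ∑[ i < n ] ∑[ j < n ] 𝟙 (inversion i j)
  I-∑ = trans (sum-map-tabulate (λ i → countᵇ (inversion i) (allFin n)) (λ i → i))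
              (sum-cong-≗ λ i → countᵇ-tabulate (inversion i) (λ j → j))

  cyc-∑ : cyc π ≡ ∑[ i < n ] 𝟙 (isCycleMin π i)
  cyc-∑ = countᵇ-tabulate (isCycleMin π) (λ i → i)

-- Orbits and cycle minima

toℕ-<-cong : ∀ {n} {u v x y : Fin n} → u ≡ x → v ≡ y → toℕ x < toℕ y → toℕ u < toℕ v
toℕ-<-cong refl refl x<y = x<y

⟨$⟩ʳ-injective : ∀ {n} (π : Permutation′ n) {x y} → π ⟨$⟩ʳ x ≡ π ⟨$⟩ʳ y → x ≡ y
⟨$⟩ʳ-injective π {x} {y} eq = trans (sym (inverseˡ π)) (trans (cong (π ⟨$⟩ˡ_) eq) (inverseˡ π))

iter-+ : ∀ {n} (π : Permutation′ n) m k x → iter π (m + k) x ≡ iter π m (iter π k x)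
iter-+ π zero k x = refl
iter-+ π (suc m) k x = cong (π ⟨$⟩ʳ_) (iter-+ π m k x)

iter-suc : ∀ {n} (π : Permutation′ n) k x → iter π (suc k) x ≡ iter π k (π ⟨$⟩ʳ x)
iter-suc π k x = trans (cong (λ m → iter π m x) (+-comm 1 k)) (iter-+ π k 1 x)

module Orbit {n : ℕ} (π : Permutation′ n) where

  open ≡-Reasoning

  iter-injective : ∀ k {x y} → iter π k x ≡ iter π k y → x ≡ y
  iter-injective zero eq = eq
  iter-injective (suc k) eq = iter-injective k (⟨$⟩ʳ-injective π eq)

  period : ∀ x → ∃[ p ] (suc p ≤ n × iter π (suc p) x ≡ x)
  period x with pigeonhole (n<1+n n) (λ (t : Fin (suc n)) → iter π (toℕ t) x)
  ... | i , j , i<j , πⁱx≡πʲx with m≤n⇒∃[o]m+o≡n i<j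
  ... | o , i+1+o≡j = o , 1+o≤n , iter-injective (toℕ i) (begin
    iter π (toℕ i) (iter π (suc o) x) ≡⟨ iter-+ π (toℕ i) (suc o) x ⟨
    iter π (toℕ i + suc o) x          ≡⟨ cong (λ k → iter π k x) (trans (+-suc (toℕ i) o) i+1+o≡j) ⟩
    iter π (toℕ j) x                  ≡⟨ πⁱx≡πʲx ⟨
    iter π (toℕ i) x                  ∎)
    where
    1+o≤n : suc o ≤ n
    1+o≤n = ≤-trans (subst (suc o ≤_) i+1+o≡j (s≤s (m≤n+m o (toℕ i)))) (s≤s⁻¹ (toℕ<n j))

  iter-periodic : ∀ {p x} → iter π p x ≡ x → ∀ q → iter π (q * p) x ≡ x
  iter-periodic πᵖx≡x zero = refl
  iter-periodic {p} {x} πᵖx≡x (suc q) = begin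
    iter π (p + q * p) x        ≡⟨ iter-+ π p (q * p) x ⟩
    iter π p (iter π (q * p) x) ≡⟨ cong (iter π p) (iter-periodic πᵖx≡x q) ⟩
    iter π p x                  ≡⟨ πᵖx≡x ⟩
    x                           ∎

  infix 4 _↝_
  _↝_ : Fin n → Fin n → Set
  x ↝ y = ∃[ m ] iter π m x ≡ y

  ↝-refl : ∀ {x} → x ↝ x
  ↝-refl = 0 , refl

  ↝-step : ∀ {x y} → x ↝ y → x ↝ π ⟨$⟩ʳ y
  ↝-step (m , refl) = suc m , refl

  ↝-trans : ∀ {x y z} → x ↝ y → y ↝ z → x ↝ z
  ↝-trans {x} (m , refl) (k , refl) = k + m , iter-+ π k m x

  ↝-sym : ∀ {x y} → x ↝ y → y ↝ x
  ↝-sym {x} (m , refl) with period x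
  ... | p , _ , πᵖx≡x = m * p , (begin
    iter π (m * p) (iter π m x) ≡⟨ iter-+ π (m * p) m x ⟨
    iter π (m * p + m) x        ≡⟨ cong (λ k → iter π k x) (trans (+-comm (m * p) m) (sym (*-suc m p))) ⟩
    iter π (m * suc p) x        ≡⟨ iter-periodic πᵖx≡x m ⟩
    x                           ∎)

  ↝-bounded : ∀ {x y} → x ↝ y → ∃[ k ] (k < n × iter π k x ≡ y)
  ↝-bounded {x} (m , refl) with period x
  ... | p , p<n , πᵖx≡x = m % suc p , <-≤-trans (m%n<n m (suc p)) p<n , (begin
    iter π (m % suc p) x
      ≡⟨ cong (iter π (m % suc p)) (iter-periodic πᵖx≡x (m / suc p)) ⟨
    iter π (m % suc p) (iter π (m / suc p * suc p) x)
      ≡⟨ iter-+ π (m % suc p) _ x ⟨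
    iter π (m % suc p + m / suc p * suc p) x
      ≡⟨ cong (λ k → iter π k x) (m≡m%n+[m/n]*n m (suc p)) ⟨
    iter π m x
      ∎)

  CycleMin : Fin n → Set
  CycleMin x = ∀ {y} → x ↝ y → toℕ x ≤ toℕ y

  private
    returnsAbove : Fin n → ℕ → Bool
    returnsAbove x k = toℕ x ≤ᵇ toℕ (iter π k x)

  isCycleMin⇒CycleMin : ∀ {x} → IsTrue (isCycleMin π x) → CycleMin x
  isCycleMin⇒CycleMin {x} cm x↝y with ↝-bounded x↝y
  ... | k , k<n , refl = ≤ᵇ⇒≤ _ _ (applyUpTo⁻ (λ k → k) n (to cm) k<n)
    where open Equivalence (allᵇ⇔All (returnsAbove x) (upTo n))

  CycleMin⇒isCycleMin : ∀ {x} → CycleMin x → IsTrue (isCycleMin π x)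
  CycleMin⇒isCycleMin {x} cm = from (applyUpTo⁺₁ (λ k → k) n λ {k} _ → ≤⇒≤ᵇ (cm (k , refl)))
    where open Equivalence (allᵇ⇔All (returnsAbove x) (upTo n))

  ¬isCycleMin⇒descent : ∀ {x} → ¬ IsTrue (isCycleMin π x) → ∃[ k ] toℕ (iter π k x) < toℕ x
  ¬isCycleMin⇒descent {x} ¬cm =
    let k , _ , x≰πᵏx = Any.applyUpTo⁻ (λ k → k) (¬All⇒Any¬ (T? ∘ returnsAbove x) (upTo n) (¬cm ∘ from))
    in k , ≰⇒> (x≰πᵏx ∘ ≤⇒≤ᵇ)
    where open Equivalence (allᵇ⇔All (returnsAbove x) (upTo n))

  module _ {S : Fin n → Set} (S? : Decidable S) where

    exit : ∀ m {y} → S y → ¬ S (iter π m y) → ∃[ z ] (S z × ¬ S (π ⟨$⟩ʳ z))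
    exit zero Sy ¬Sy = contradiction Sy ¬Sy
    exit (suc m) {y} Sy ¬Sπᵐ⁺¹y with S? (iter π m y)
    ... | yes Sπᵐy = iter π m y , Sπᵐy , ¬Sπᵐ⁺¹y
    ... | no ¬Sπᵐy = exit m Sy ¬Sπᵐy

    escape : ∀ {x} → S (π ⟨$⟩ʳ x) → ¬ S x → ∃[ z ] (S z × ¬ S (π ⟨$⟩ʳ z))
    escape {x} Sπx ¬Sx = let m , πᵐπx≡x = ↝-sym (↝-step ↝-refl) in
      exit m Sπx (subst (λ z → ¬ S z) (sym πᵐπx≡x) ¬Sx)

-- The inverse permutation

module _ {n : ℕ} (π : Permutation′ n) where

  open ≡-Reasoning
  private
    σ = flip π

  iter-flip : ∀ k x → iter π k (iter σ k x) ≡ x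
  iter-flip zero x = refl
  iter-flip (suc k) x = begin
    iter π (suc k) (iter σ (suc k) x) ≡⟨ iter-suc π k _ ⟩
    iter π k (π ⟨$⟩ʳ (σ ⟨$⟩ʳ iter σ k x)) ≡⟨ cong (iter π k) (inverseʳ π) ⟩
    iter π k (iter σ k x)              ≡⟨ iter-flip k x ⟩
    x                                  ∎

  ↝-flip : ∀ {x y} → Orbit._↝_ σ x y → Orbit._↝_ π y x
  ↝-flip {x} (k , refl) = k , iter-flip k x

  CycleMin-flip : ∀ {x} → Orbit.CycleMin π x → Orbit.CycleMin σ x
  CycleMin-flip cm x↝y = cm (Orbit.↝-sym π (↝-flip x↝y))

module _ {n : ℕ} (π : Permutation′ n) where

  open ≡-Reasoning
  private
    σ = flip π

  isCycleMin-flip : ∀ x → isCycleMin σ x ≡ isCycleMin π x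
  isCycleMin-flip x = IsTrue-injective
    (λ cm → Orbit.CycleMin⇒isCycleMin π (CycleMin-flip σ (Orbit.isCycleMin⇒CycleMin σ {x} cm)))
    (λ cm → Orbit.CycleMin⇒isCycleMin σ (CycleMin-flip π (Orbit.isCycleMin⇒CycleMin π {x} cm)))

  T-flip : T σ ≡ T π
  T-flip = cong (n ∸_) (begin
    cyc σ                                  ≡⟨ cyc-∑ σ ⟩
    ∑[ i < n ] 𝟙 (isCycleMin σ i)          ≡⟨ sum-cong-≗ (cong 𝟙 ∘ isCycleMin-flip) ⟩
    ∑[ i < n ] 𝟙 (isCycleMin π i)          ≡⟨ cyc-∑ π ⟨
    cyc π                                  ∎)

  D-flip : D σ ≡ D π
  D-flip = begin
    D σ                                                    ≡⟨ D-∑ σ ⟩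
    ∑[ i < n ] ∣ toℕ (σ ⟨$⟩ʳ i) - toℕ i ∣
      ≡⟨ sum-permute (λ i → ∣ toℕ (σ ⟨$⟩ʳ i) - toℕ i ∣) π ⟩
    ∑[ i < n ] ∣ toℕ (σ ⟨$⟩ʳ (π ⟨$⟩ʳ i)) - toℕ (π ⟨$⟩ʳ i) ∣
      ≡⟨ sum-cong-≗ (λ i → trans (cong (λ j → ∣ toℕ j - toℕ (π ⟨$⟩ʳ i) ∣) (inverseˡ π))
                                 (∣-∣-comm (toℕ i) _)) ⟩
    ∑[ i < n ] ∣ toℕ (π ⟨$⟩ʳ i) - toℕ i ∣                  ≡⟨ D-∑ π ⟨
    D π                                                    ∎

  I-flip : I σ ≡ I π
  I-flip = begin
    I σ                                                   ≡⟨ I-∑ σ ⟩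
    ∑[ i < n ] ∑[ j < n ] 𝟙 (inversion σ i j)
      ≡⟨ sum-permute (λ i → ∑[ j < n ] 𝟙 (inversion σ i j)) π ⟩
    ∑[ i < n ] ∑[ j < n ] 𝟙 (inversion σ (π ⟨$⟩ʳ i) j)
      ≡⟨ sum-cong-≗ (λ i → sum-permute (λ j → 𝟙 (inversion σ (π ⟨$⟩ʳ i) j)) π) ⟩
    ∑[ i < n ] ∑[ j < n ] 𝟙 (inversion σ (π ⟨$⟩ʳ i) (π ⟨$⟩ʳ j))
      ≡⟨ sum-cong-≗ (λ i → sum-cong-≗ λ j → cong 𝟙 (inversion-flip i j)) ⟩
    ∑[ i < n ] ∑[ j < n ] 𝟙 (inversion π j i)             ≡⟨ ∑-comm (λ i j → 𝟙 (inversion π j i)) ⟩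
    ∑[ j < n ] ∑[ i < n ] 𝟙 (inversion π j i)             ≡⟨ I-∑ π ⟨
    I π                                                   ∎
    where
    inversion-flip : ∀ i j → inversion σ (π ⟨$⟩ʳ i) (π ⟨$⟩ʳ j) ≡ inversion π j i
    inversion-flip i j rewrite inverseˡ π {i} | inverseˡ π {j} =
      ∧-comm (toℕ (π ⟨$⟩ʳ i) <ᵇ toℕ (π ⟨$⟩ʳ j)) (toℕ j <ᵇ toℕ i)

  Shallow-flip : Shallow π → Shallow σ
  Shallow-flip shallow = begin
    I σ + T σ ≡⟨ cong₂ _+_ I-flip T-flip ⟩
    I π + T π ≡⟨ shallow ⟩
    D π       ≡⟨ D-flip ⟨
    D σ       ∎

-- Swapping two values

module _ {n : ℕ} (a b : Fin n) where

  transpose-matchˡ : PC.transpose a b a ≡ b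
  transpose-matchˡ rewrite dec-true (a ≟ a) refl = refl

  transpose-matchʳ : PC.transpose a b b ≡ a
  transpose-matchʳ with b ≟ a
  ... | yes b≡a = b≡a
  ... | no _ rewrite dec-true (b ≟ b) refl = refl

  transpose-other : ∀ {x} → x ≢ a → x ≢ b → PC.transpose a b x ≡ x
  transpose-other {x} x≢a x≢b rewrite dec-false (x ≟ a) x≢a | dec-false (x ≟ b) x≢b = refl

  TransposeCase : Fin n → Set
  TransposeCase x = (x ≡ a × PC.transpose a b x ≡ b) ⊎ (x ≡ b × PC.transpose a b x ≡ a)
                  ⊎ (x ≢ a × x ≢ b × PC.transpose a b x ≡ x)

  transpose-cases : ∀ x → TransposeCase x
  transpose-cases x = cases (x ≟ a) (x ≟ b)
    where
    cases : Dec (x ≡ a) → Dec (x ≡ b) → TransposeCase x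
    cases (yes x≡a) _ = inj₁ (x≡a , trans (cong (PC.transpose a b) x≡a) transpose-matchˡ)
    cases (no x≢a) (yes x≡b) = inj₂ (inj₁ (x≡b , trans (cong (PC.transpose a b) x≡b) transpose-matchʳ))
    cases (no x≢a) (no x≢b) = inj₂ (inj₂ (x≢a , x≢b , transpose-other x≢a x≢b))

  transpose-involutive : ∀ x → PC.transpose a b (PC.transpose a b x) ≡ x
  transpose-involutive x with transpose-cases x
  ... | inj₁ (refl , tx≡b) = trans (cong (PC.transpose a b) tx≡b) transpose-matchʳ
  ... | inj₂ (inj₁ (refl , tx≡a)) = trans (cong (PC.transpose a b) tx≡a) transpose-matchˡ
  ... | inj₂ (inj₂ (_ , _ , tx≡x)) = trans (cong (PC.transpose a b) tx≡x) tx≡x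

swapAt : ∀ {n} → Fin n → Fin n → Permutation′ n → Permutation′ n
swapAt a b π = transpose a b ∘ₚ π

module _ {n : ℕ} (π : Permutation′ n) {a b : Fin n} where

  swapAt-matchˡ : swapAt a b π ⟨$⟩ʳ a ≡ π ⟨$⟩ʳ b
  swapAt-matchˡ = cong (π ⟨$⟩ʳ_) (transpose-matchˡ a b)

  swapAt-matchʳ : swapAt a b π ⟨$⟩ʳ b ≡ π ⟨$⟩ʳ a
  swapAt-matchʳ = cong (π ⟨$⟩ʳ_) (transpose-matchʳ a b)

  swapAt-outside : ∀ {x} → toℕ a < toℕ b → toℕ x < toℕ a ⊎ toℕ b < toℕ x →
                   swapAt a b π ⟨$⟩ʳ x ≡ π ⟨$⟩ʳ x
  swapAt-outside a<b (inj₁ x<a) =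
    cong (π ⟨$⟩ʳ_) (transpose-other a b (Finₚ.<⇒≢ x<a) (Finₚ.<⇒≢ (<-trans x<a a<b)))
  swapAt-outside a<b (inj₂ b<x) =
    cong (π ⟨$⟩ʳ_) (transpose-other a b (≢-sym (Finₚ.<⇒≢ (<-trans a<b b<x))) (≢-sym (Finₚ.<⇒≢ b<x)))

∑-transpose : ∀ {n} (a b : Fin n) (f : Fin n → ℕ) → sum f ≡ ∑[ x < n ] f (PC.transpose a b x)
∑-transpose a b f = sum-permute f (transpose a b)

module _ {n : ℕ} (π : Permutation′ n) (a b : Fin n) where

  private
    π′ = swapAt a b π
    t = PC.transpose a b
    module O = Orbit π
    module O′ = Orbit π′
  open O′ using (_↝_)

  Hits : Fin n → Set
  Hits x = ∃[ c ] (x ↝ c × (c ≡ a ⊎ c ≡ b))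

  agree-or-hits : ∀ k x → iter π k x ≡ iter π′ k x ⊎ Hits x
  agree-or-hits zero x = inj₁ refl
  agree-or-hits (suc k) x with agree-or-hits k x
  ... | inj₂ hits = inj₂ hits
  ... | inj₁ πᵏx≡π′ᵏx with transpose-cases a b (iter π′ k x)
  ...   | inj₁ (≡a , _) = inj₂ (_ , (k , refl) , inj₁ ≡a)
  ...   | inj₂ (inj₁ (≡b , _)) = inj₂ (_ , (k , refl) , inj₂ ≡b)
  ...   | inj₂ (inj₂ (_ , _ , fixed)) = inj₁ (cong (π ⟨$⟩ʳ_) (trans πᵏx≡π′ᵏx (sym fixed)))

  new-cycleMin-hits : ∀ {x} → O′.CycleMin x → ¬ IsTrue (isCycleMin π x) → Hits x
  new-cycleMin-hits {x} cm′ ¬cm with O.¬isCycleMin⇒descent ¬cm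
  ... | k , πᵏx<x with agree-or-hits k x
  ...   | inj₂ hits = hits
  ...   | inj₁ πᵏx≡π′ᵏx = contradiction (cm′ (k , sym πᵏx≡π′ᵏx)) (<⇒≱ πᵏx<x)

  closed-under-π : (U : Fin n → Set) → (∀ {z} → U z → U (π′ ⟨$⟩ʳ z)) → U a → U b →
                   ∀ {z} → U z → U (π ⟨$⟩ʳ z)
  closed-under-π U closed Ua Ub {z} Uz =
    subst (λ w → U (π ⟨$⟩ʳ w)) (transpose-involutive a b z) (closed (Ut (transpose-cases a b z)))
    where
    Ut : TransposeCase a b z → U (t z)
    Ut (inj₁ (_ , tz≡b)) = subst U (sym tz≡b) Ub
    Ut (inj₂ (inj₁ (_ , tz≡a))) = subst U (sym tz≡a) Ua
    Ut (inj₂ (inj₂ (_ , _ , tz≡z))) = subst U (sym tz≡z) Uz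

  private
    Reaches : Fin n → Fin n → Fin n → Set
    Reaches x y z = x ↝ z ⊎ y ↝ z

  separate-hits-impossible : ∀ {x y} → toℕ x ≤ toℕ y → O′.CycleMin x → O′.CycleMin y →
                             ¬ IsTrue (isCycleMin π x) → Reaches x y a → Reaches x y b → ⊥
  separate-hits-impossible {x} {y} x≤y cmx cmy ¬cmx reach-a reach-b =
    ¬cmx (O.CycleMin⇒isCycleMin λ { (k , refl) → above (iterate k) })
    where
    iterate : ∀ k → Reaches x y (iter π k x)
    iterate zero = inj₁ O′.↝-refl
    iterate (suc k) = closed-under-π (Reaches x y) (map⊎ O′.↝-step O′.↝-step) reach-a reach-b (iterate k)
    above : ∀ {z} → Reaches x y z → toℕ x ≤ toℕ z
    above (inj₁ x↝z) = cmx x↝z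
    above (inj₂ y↝z) = ≤-trans x≤y (cmy y↝z)

  -- If the π′-orbits of x and y meet {a, b} in different points, their union is closed under
  -- π = π′ ∘ (a b), so the smaller of x and y would be a cycle minimum of π.
  new-cycleMin-unique : ∀ {x y} → O′.CycleMin x → ¬ IsTrue (isCycleMin π x) →
                        O′.CycleMin y → ¬ IsTrue (isCycleMin π y) → x ≡ y
  new-cycleMin-unique {x} {y} cmx ¬cmx cmy ¬cmy
    with new-cycleMin-hits cmx ¬cmx | new-cycleMin-hits cmy ¬cmy
  ... | c , x↝c , c∈ab | d , y↝d , d∈ab with c ≟ d
  ...   | yes refl = toℕ-injective (≤-antisym (cmx (O′.↝-trans x↝c (O′.↝-sym y↝d)))
                                               (cmy (O′.↝-trans y↝d (O′.↝-sym x↝c))))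
  ...   | no c≢d with reaches-both c∈ab d∈ab | ≤-total (toℕ x) (toℕ y)
    where
    reaches-both : (c ≡ a ⊎ c ≡ b) → (d ≡ a ⊎ d ≡ b) → Reaches x y a × Reaches x y b
    reaches-both (inj₁ refl) (inj₁ refl) = contradiction refl c≢d
    reaches-both (inj₁ refl) (inj₂ refl) = inj₁ x↝c , inj₂ y↝d
    reaches-both (inj₂ refl) (inj₁ refl) = inj₂ y↝d , inj₁ x↝c
    reaches-both (inj₂ refl) (inj₂ refl) = contradiction refl c≢d
  ...     | reach-a , reach-b | inj₁ x≤y = ⊥-elim (separate-hits-impossible x≤y cmx cmy ¬cmx reach-a reach-b)
  ...     | reach-a , reach-b | inj₂ y≤x =
    ⊥-elim (separate-hits-impossible y≤x cmy cmx ¬cmy (swap⊎ reach-a) (swap⊎ reach-b))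

  cyc-swapAt : cyc π′ ≤ suc (cyc π)
  cyc-swapAt = begin
    cyc π′                                       ≡⟨ cyc-∑ π′ ⟩
    sum (𝟙 ∘ isCycleMin π′)                      ≤⟨ ∑-mono-≤ (λ x → 𝟙-≤-+ (isCycleMin π′ x) _) ⟩
    ∑[ x < n ] (𝟙 (isCycleMin π x) + 𝟙 (new x))  ≡⟨ ∑-distrib-+ (𝟙 ∘ isCycleMin π) (𝟙 ∘ new) ⟩
    sum (𝟙 ∘ isCycleMin π) + sum (𝟙 ∘ new)       ≤⟨ +-monoʳ-≤ _ (∑-𝟙-≤1 new new-unique) ⟩
    sum (𝟙 ∘ isCycleMin π) + 1                   ≡⟨ cong (_+ 1) (cyc-∑ π) ⟨
    cyc π + 1                                    ≡⟨ +-comm (cyc π) 1 ⟩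
    suc (cyc π)                                  ∎
    where
    open ≤-Reasoning
    new : Fin n → Bool
    new x = isCycleMin π′ x ∧ not (isCycleMin π x)
    new-unique : ∀ {x y} → IsTrue (new x) → IsTrue (new y) → x ≡ y
    new-unique newx newy =
      let cmx , ¬cmx = Equivalence.to T-∧ newx ; cmy , ¬cmy = Equivalence.to T-∧ newy
      in new-cycleMin-unique (O′.isCycleMin⇒CycleMin cmx) (IsTrue-not ¬cmx)
                             (O′.isCycleMin⇒CycleMin cmy) (IsTrue-not ¬cmy)

  T-swapAt : T π ≤ suc (T π′)
  T-swapAt = m≤n+o⇒m∸n≤o n (cyc π) (begin
    n                       ≤⟨ m≤n+m∸n n (cyc π′) ⟩
    cyc π′ + (n ∸ cyc π′)   ≤⟨ +-monoˡ-≤ _ cyc-swapAt ⟩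
    suc (cyc π) + (n ∸ cyc π′) ≡⟨ +-suc (cyc π) _ ⟨
    cyc π + suc (n ∸ cyc π′) ∎)
    where open ≤-Reasoning

module _ {n : ℕ} (π : Permutation′ n) {a b : Fin n} (a<b : toℕ a < toℕ b) where

  private
    π′ = swapAt a b π
    t = PC.transpose a b
    A = toℕ a
    B = toℕ b
    c = B ∸ A
    πₓ : Fin n → ℕ
    πₓ x = toℕ (π ⟨$⟩ʳ x)

  transpose-reverses : ∀ {p q} → toℕ p < toℕ q → ¬ toℕ (t p) < toℕ (t q) →
                       (p ≡ a × A < toℕ q × toℕ q ≤ B) ⊎ (q ≡ b × A < toℕ p × toℕ p < B)
  transpose-reverses {p} {q} p<q tp≮tq with transpose-cases a b p | transpose-cases a b q
  ... | inj₁ (refl , _) | inj₁ (refl , _) = contradiction p<q (<-irrefl refl)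
  ... | inj₁ (refl , _) | inj₂ (inj₁ (refl , _)) = inj₁ (refl , a<b , ≤-refl)
  ... | inj₁ (refl , tp≡b) | inj₂ (inj₂ (_ , _ , tq≡q)) =
    inj₁ (refl , p<q , ≮⇒≥ (tp≮tq ∘ toℕ-<-cong tp≡b tq≡q))
  ... | inj₂ (inj₁ (refl , _)) | inj₁ (refl , _) = contradiction p<q (<-asym a<b)
  ... | inj₂ (inj₁ (refl , _)) | inj₂ (inj₁ (refl , _)) = contradiction p<q (<-irrefl refl)
  ... | inj₂ (inj₁ (refl , tp≡a)) | inj₂ (inj₂ (_ , _ , tq≡q)) =
    contradiction (toℕ-<-cong tp≡a tq≡q (<-trans a<b p<q)) tp≮tq
  ... | inj₂ (inj₂ (_ , _ , tp≡p)) | inj₁ (refl , tq≡b) =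
    contradiction (toℕ-<-cong tp≡p tq≡b (<-trans p<q a<b)) tp≮tq
  ... | inj₂ (inj₂ (p≢a , _ , tp≡p)) | inj₂ (inj₁ (refl , tq≡a)) =
    inj₂ (refl , ≤∧≢⇒< (≮⇒≥ (tp≮tq ∘ toℕ-<-cong tp≡p tq≡a)) (p≢a ∘ toℕ-injective ∘ sym) , p<q)
  ... | inj₂ (inj₂ (_ , _ , tp≡p)) | inj₂ (inj₂ (_ , _ , tq≡q)) =
    contradiction (toℕ-<-cong tp≡p tq≡q p<q) tp≮tq

  -- The inversions (a, q) with a < q ≤ b and (p, b) with a < p < b: the only ones the swap can undo.
  lostˡ lostʳ : Fin n → ℕ
  lostˡ q = 𝟙 (inRange A (suc B) (toℕ q) ∧ (πₓ q <ᵇ πₓ a))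
  lostʳ p = 𝟙 (inRange A B (toℕ p) ∧ (πₓ b <ᵇ πₓ p))

  inversion-swapAt : ∀ p q → 𝟙 (inversion π p q) ≤
    𝟙 ((toℕ (t p) <ᵇ toℕ (t q)) ∧ (πₓ q <ᵇ πₓ p)) + ((a ↦ lostˡ q) p + (b ↦ lostʳ p) q)
  inversion-swapAt p q = 𝟙-≤ witness
    where
    kept lostᵃ lostᵇ : ℕ
    kept = 𝟙 ((toℕ (t p) <ᵇ toℕ (t q)) ∧ (πₓ q <ᵇ πₓ p))
    lostᵃ = (a ↦ lostˡ q) p
    lostᵇ = (b ↦ lostʳ p) q
    witness : IsTrue (inversion π p q) → 1 ≤ kept + (lostᵃ + lostᵇ)
    witness inv with ∧-<ᵇ⁻ {toℕ p} {toℕ q} {πₓ q} {πₓ p} inv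
    ... | p<q , πq<πp with toℕ (t p) <? toℕ (t q)
    ...   | yes tp<tq = ≤-trans (≤-reflexive (sym (𝟙-∧-<ᵇ tp<tq πq<πp))) (m≤m+n kept (lostᵃ + lostᵇ))
    ...   | no tp≮tq with transpose-reverses {p} {q} p<q tp≮tq
    ...     | inj₁ (refl , a<q , q≤b) =
      ≤-trans (≤-reflexive (sym (trans (↦-same a _) (𝟙-∧ (∧-<ᵇ⁺ (s≤s q≤b) a<q) (<⇒<ᵇ πq<πp)))))
              (≤-trans (m≤m+n lostᵃ lostᵇ) (m≤n+m (lostᵃ + lostᵇ) kept))
    ...     | inj₂ (refl , a<p , p<b) =
      ≤-trans (≤-reflexive (sym (trans (↦-same b _) (𝟙-∧ (∧-<ᵇ⁺ p<b a<p) (<⇒<ᵇ πq<πp)))))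
              (≤-trans (m≤n+m lostᵇ lostᵃ) (m≤n+m (lostᵃ + lostᵇ) kept))

  I-swapAt-∑ : I π′ ≡ ∑[ p < n ] ∑[ q < n ] 𝟙 ((toℕ (t p) <ᵇ toℕ (t q)) ∧ (πₓ q <ᵇ πₓ p))
  I-swapAt-∑ = begin
    I π′
      ≡⟨ I-∑ π′ ⟩
    ∑[ p < n ] ∑[ q < n ] 𝟙 (inversion π′ p q)
      ≡⟨ ∑-transpose a b (λ p → ∑[ q < n ] 𝟙 (inversion π′ p q)) ⟩
    ∑[ p < n ] ∑[ q < n ] 𝟙 (inversion π′ (t p) q)
      ≡⟨ sum-cong-≗ (λ p → ∑-transpose a b (λ q → 𝟙 (inversion π′ (t p) q))) ⟩
    ∑[ p < n ] ∑[ q < n ] 𝟙 (inversion π′ (t p) (t q))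
      ≡⟨ sum-cong-≗ (λ p → sum-cong-≗ λ q → cong 𝟙 (untwist p q)) ⟩
    ∑[ p < n ] ∑[ q < n ] 𝟙 ((toℕ (t p) <ᵇ toℕ (t q)) ∧ (πₓ q <ᵇ πₓ p))
      ∎
    where
    open ≡-Reasoning
    untwist : ∀ p q → inversion π′ (t p) (t q) ≡ (toℕ (t p) <ᵇ toℕ (t q)) ∧ (πₓ q <ᵇ πₓ p)
    untwist p q rewrite transpose-involutive a b p | transpose-involutive a b q = refl

  I-swapAt : I π ≤ I π′ + (sum lostˡ + sum lostʳ)
  I-swapAt = begin
    I π                                                   ≡⟨ I-∑ π ⟩
    ∑[ p < n ] ∑[ q < n ] 𝟙 (inversion π p q)             ≤⟨ ∑-mono-≤ (λ p → ∑-mono-≤ (inversion-swapAt p)) ⟩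
    ∑[ p < n ] ∑[ q < n ] (kept p q + (lostᵃ p q + lostᵇ p q))
      ≡⟨ sum-cong-≗ (λ p → ∑-+-+ (kept p) (lostᵃ p) (lostᵇ p)) ⟩
    ∑[ p < n ] (sum (kept p) + (sum (lostᵃ p) + sum (lostᵇ p)))
      ≡⟨ ∑-+-+ (sum ∘ kept) (sum ∘ lostᵃ) (sum ∘ lostᵇ) ⟩
    ∑[ p < n ] sum (kept p) + (∑[ p < n ] sum (lostᵃ p) + ∑[ p < n ] sum (lostᵇ p))
      ≡⟨ cong₂ _+_ (sym I-swapAt-∑) (cong₂ _+_ (trans (∑-comm lostᵃ) (sum-cong-≗ λ q → ∑-↦ a (lostˡ q)))
                                                (sum-cong-≗ λ p → ∑-↦ b (lostʳ p))) ⟩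
    I π′ + (sum lostˡ + sum lostʳ)                        ∎
    where
    open ≤-Reasoning
    kept lostᵃ lostᵇ : Fin n → Fin n → ℕ
    kept p q = 𝟙 ((toℕ (t p) <ᵇ toℕ (t q)) ∧ (πₓ q <ᵇ πₓ p))
    lostᵃ p q = (a ↦ lostˡ q) p
    lostᵇ p q = (b ↦ lostʳ p) q

  private
    lostˡ≤inRange : ∀ q → lostˡ q ≤ 𝟙 (inRange A (suc B) (toℕ q))
    lostˡ≤inRange q = 𝟙-∧-≤ˡ (inRange A (suc B) (toℕ q)) _

    lostʳ≤inRange : ∀ p → lostʳ p ≤ 𝟙 (inRange A B (toℕ p))
    lostʳ≤inRange p = 𝟙-∧-≤ˡ (inRange A B (toℕ p)) _

    B∸1+A<c : B ∸ suc A < c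
    B∸1+A<c = ∸-monoʳ-< (n<1+n A) a<b

  ∑lostˡ≤ : sum lostˡ ≤ c
  ∑lostˡ≤ = ≤-trans (∑-mono-≤ lostˡ≤inRange) (∑-inRange {n} A (suc B))

  ∑lostʳ< : sum lostʳ < c
  ∑lostʳ< = ≤-<-trans (≤-trans (∑-mono-≤ lostʳ≤inRange) (∑-inRange {n} A B)) B∸1+A<c

  ∑lostˡ<-between : ∀ k → A < toℕ k → toℕ k < B → πₓ a < πₓ k → sum lostˡ < c
  ∑lostˡ<-between k a<k k<b πa<πk = <-≤-trans
    (∑-mono-< lostˡ≤inRange k (𝟙-∧-<ˡ (inRange⁺ a<k (m<n⇒m<1+n k<b)) (<-asym πa<πk ∘ <ᵇ⇒< _ _)))
    (∑-inRange {n} A (suc B))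

  ∑lostʳ<-between : ∀ k → A < toℕ k → toℕ k < B → πₓ k < πₓ b → suc (sum lostʳ) < c
  ∑lostʳ<-between k a<k k<b πk<πb = <-≤-trans (s≤s (<-≤-trans
    (∑-mono-< lostʳ≤inRange k (𝟙-∧-<ˡ (inRange⁺ a<k k<b) (<-asym πk<πb ∘ <ᵇ⇒< _ _)))
    (∑-inRange {n} A B))) B∸1+A<c

  I-swapAt-< : 1 + I π ≤ I π′ + (c + c)
  I-swapAt-< = begin
    1 + I π                                ≤⟨ +-monoʳ-≤ 1 I-swapAt ⟩
    1 + (I π′ + (sum lostˡ + sum lostʳ))   ≡⟨ x∙yz≈y∙xz 1 (I π′) _ ⟩
    I π′ + (1 + (sum lostˡ + sum lostʳ))   ≡⟨ cong (I π′ +_) (+-suc (sum lostˡ) _) ⟨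
    I π′ + (sum lostˡ + suc (sum lostʳ))   ≤⟨ +-monoʳ-≤ (I π′) (+-mono-≤ ∑lostˡ≤ ∑lostʳ<) ⟩
    I π′ + (c + c)                         ∎
    where open ≤-Reasoning

  I-swapAt-<-between : ∀ k → A < toℕ k → toℕ k < B → πₓ a < πₓ k ⊎ πₓ k < πₓ b →
                       2 + I π ≤ I π′ + (c + c)
  I-swapAt-<-between k a<k k<b πk-outside = begin
    2 + I π                                ≤⟨ +-monoʳ-≤ 2 I-swapAt ⟩
    2 + (I π′ + (sum lostˡ + sum lostʳ))   ≡⟨ x∙yz≈y∙xz 2 (I π′) _ ⟩
    I π′ + (2 + (sum lostˡ + sum lostʳ))   ≤⟨ +-monoʳ-≤ (I π′) (lost< πk-outside) ⟩
    I π′ + (c + c)                         ∎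
    where
    open ≤-Reasoning
    lost< : πₓ a < πₓ k ⊎ πₓ k < πₓ b → 2 + (sum lostˡ + sum lostʳ) ≤ c + c
    lost< (inj₁ πa<πk) = begin
      2 + (sum lostˡ + sum lostʳ)          ≡⟨ cong suc (+-suc (sum lostˡ) _) ⟨
      suc (sum lostˡ) + suc (sum lostʳ)    ≤⟨ +-mono-≤ (∑lostˡ<-between k a<k k<b πa<πk) ∑lostʳ< ⟩
      c + c                                ∎
    lost< (inj₂ πk<πb) = begin
      2 + (sum lostˡ + sum lostʳ)          ≡⟨ trans (+-suc (sum lostˡ) _) (cong suc (+-suc (sum lostˡ) _)) ⟨
      sum lostˡ + suc (suc (sum lostʳ))    ≤⟨ +-mono-≤ ∑lostˡ≤ (∑lostʳ<-between k a<k k<b πk<πb) ⟩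
      c + c                                ∎

m≤n≤o⇒∣m-o∣≡∣m-n∣+∣n-o∣ : ∀ {m n o} → m ≤ n → n ≤ o → ∣ m - o ∣ ≡ ∣ m - n ∣ + ∣ n - o ∣
m≤n≤o⇒∣m-o∣≡∣m-n∣+∣n-o∣ {m} m≤n n≤o with m≤n⇒∃[o]m+o≡n m≤n | m≤n⇒∃[o]m+o≡n n≤o
... | u , refl | v , refl = begin
  ∣ m - m + u + v ∣                     ≡⟨ cong ∣ m -_∣ (+-assoc m u v) ⟩
  ∣ m - m + (u + v) ∣                   ≡⟨ ∣m-m+n∣≡n m (u + v) ⟩
  u + v                                 ≡⟨ cong₂ _+_ (∣m-m+n∣≡n m u) (∣m-m+n∣≡n (m + u) v) ⟨
  ∣ m - m + u ∣ + ∣ m + u - m + u + v ∣ ∎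
  where open ≡-Reasoning

1+m≤n+o⇒p≤1+q⇒m+p≤n+q+o : ∀ {m n o p q} → suc m ≤ n + o → p ≤ suc q → m + p ≤ n + q + o
1+m≤n+o⇒p≤1+q⇒m+p≤n+q+o {m} {n} {o} {p} {q} 1+m≤n+o p≤1+q = s≤s⁻¹ (begin
  suc m + p           ≤⟨ +-mono-≤ 1+m≤n+o p≤1+q ⟩
  n + o + suc q       ≡⟨ +-suc (n + o) q ⟩
  suc (n + o + q)     ≡⟨ cong suc (xy∙z≈xz∙y n o q) ⟩
  suc (n + q + o)     ∎)
  where open ≤-Reasoning

-- Swapping the values at positions a < b with π b ≤ a and b ≤ π a lowers D by 2 (b − a).
record Reducing {n} (π : Permutation′ n) (a b : Fin n) : Set where
  constructor reducing
  field
    πb≤a : toℕ (π ⟨$⟩ʳ b) ≤ toℕ a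
    a<b  : toℕ a < toℕ b
    b≤πa : toℕ b ≤ toℕ (π ⟨$⟩ʳ a)

module _ {n : ℕ} {π : Permutation′ n} {a b : Fin n} (red : Reducing π a b) where

  open Reducing red

  private
    π′ = swapAt a b π
    t = PC.transpose a b
    A = toℕ a
    B = toℕ b
    c = B ∸ A
    a≢b = Finₚ.<⇒≢ a<b

  open ≡-Reasoning

  displacement-swapAt : ∀ x → ∣ toℕ (π ⟨$⟩ʳ x) - toℕ x ∣ ≡
                              ∣ toℕ (π ⟨$⟩ʳ x) - toℕ (t x) ∣ + ((a ↦ c) x + (b ↦ c) x)
  displacement-swapAt x with transpose-cases a b x
  ... | inj₁ (refl , ta≡b) = begin
    ∣ πa - A ∣                ≡⟨ ∣-∣-comm πa A ⟩
    ∣ A - πa ∣                ≡⟨ m≤n≤o⇒∣m-o∣≡∣m-n∣+∣n-o∣ (<⇒≤ a<b) b≤πa ⟩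
    ∣ A - B ∣ + ∣ B - πa ∣    ≡⟨ +-comm ∣ A - B ∣ _ ⟩
    ∣ B - πa ∣ + ∣ A - B ∣    ≡⟨ cong₂ _+_ (∣-∣-comm B πa) (m≤n⇒∣m-n∣≡n∸m (<⇒≤ a<b)) ⟩
    ∣ πa - B ∣ + c            ≡⟨ cong₂ (λ y z → ∣ πa - toℕ y ∣ + z) ta≡b
                                       (trans (cong₂ _+_ (↦-same a c) (↦-other c a≢b)) (+-identityʳ c)) ⟨
    ∣ πa - toℕ (t a) ∣ + ((a ↦ c) a + (b ↦ c) a) ∎
    where πa = toℕ (π ⟨$⟩ʳ a)
  ... | inj₂ (inj₁ (refl , tb≡a)) = begin
    ∣ πb - B ∣                ≡⟨ m≤n≤o⇒∣m-o∣≡∣m-n∣+∣n-o∣ πb≤a (<⇒≤ a<b) ⟩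
    ∣ πb - A ∣ + ∣ A - B ∣    ≡⟨ cong (∣ πb - A ∣ +_) (m≤n⇒∣m-n∣≡n∸m (<⇒≤ a<b)) ⟩
    ∣ πb - A ∣ + c            ≡⟨ cong₂ (λ y z → ∣ πb - toℕ y ∣ + z) tb≡a
                                       (cong₂ _+_ (↦-other c (a≢b ∘ sym)) (↦-same b c)) ⟨
    ∣ πb - toℕ (t b) ∣ + ((a ↦ c) b + (b ↦ c) b) ∎
    where πb = toℕ (π ⟨$⟩ʳ b)
  ... | inj₂ (inj₂ (x≢a , x≢b , tx≡x)) = sym (begin
    ∣ πx - toℕ (t x) ∣ + ((a ↦ c) x + (b ↦ c) x)
      ≡⟨ cong₂ (λ y z → ∣ πx - toℕ y ∣ + z) tx≡x (cong₂ _+_ (↦-other c x≢a) (↦-other c x≢b)) ⟩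
    ∣ πx - toℕ x ∣ + 0 ≡⟨ +-identityʳ _ ⟩
    ∣ πx - toℕ x ∣ ∎)
    where πx = toℕ (π ⟨$⟩ʳ x)

  D-swapAt : D π ≡ D π′ + (c + c)
  D-swapAt = begin
    D π                                                        ≡⟨ D-∑ π ⟩
    ∑[ x < n ] ∣ πₓ x - toℕ x ∣                               ≡⟨ sum-cong-≗ displacement-swapAt ⟩
    ∑[ x < n ] (∣ πₓ x - toℕ (t x) ∣ + ((a ↦ c) x + (b ↦ c) x))
      ≡⟨ ∑-distrib-+ (λ x → ∣ πₓ x - toℕ (t x) ∣) (λ x → (a ↦ c) x + (b ↦ c) x) ⟩
    ∑[ x < n ] ∣ πₓ x - toℕ (t x) ∣ + ∑[ x < n ] ((a ↦ c) x + (b ↦ c) x)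
      ≡⟨ cong₂ _+_ (sym D′-∑) (trans (∑-distrib-+ (a ↦ c) (b ↦ c)) (cong₂ _+_ (∑-↦ a c) (∑-↦ b c))) ⟩
    D π′ + (c + c)                                             ∎
    where
    πₓ : Fin n → ℕ
    πₓ x = toℕ (π ⟨$⟩ʳ x)
    D′-∑ : D π′ ≡ ∑[ x < n ] ∣ πₓ x - toℕ (t x) ∣
    D′-∑ = begin
      D π′                                  ≡⟨ D-∑ π′ ⟩
      ∑[ x < n ] ∣ πₓ (t x) - toℕ x ∣       ≡⟨ ∑-transpose a b _ ⟩
      ∑[ x < n ] ∣ πₓ (t (t x)) - toℕ (t x) ∣
        ≡⟨ sum-cong-≗ (λ x → cong (λ y → ∣ πₓ y - toℕ (t x) ∣) (transpose-involutive a b x)) ⟩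
      ∑[ x < n ] ∣ πₓ x - toℕ (t x) ∣       ∎

  I+T-swapAt : I π + T π ≤ I π′ + T π′ + (c + c)
  I+T-swapAt = 1+m≤n+o⇒p≤1+q⇒m+p≤n+q+o {n = I π′} (I-swapAt-< π a<b) (T-swapAt π a b)

  I+T-swapAt-between : ∀ k → A < toℕ k → toℕ k < B →
                       toℕ (π ⟨$⟩ʳ a) < toℕ (π ⟨$⟩ʳ k) ⊎ toℕ (π ⟨$⟩ʳ k) < toℕ (π ⟨$⟩ʳ b) →
                       suc (I π + T π) ≤ I π′ + T π′ + (c + c)
  I+T-swapAt-between k a<k k<b πk-outside =
    1+m≤n+o⇒p≤1+q⇒m+p≤n+q+o {n = I π′} (I-swapAt-<-between π a<b k a<k k<b πk-outside) (T-swapAt π a b)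

  D-swapAt-< : D π′ < D π
  D-swapAt-< = subst (D π′ <_) (sym D-swapAt) (m<m+n (D π′) (<-≤-trans (m<n⇒0<n∸m a<b) (m≤m+n c c)))

-- The Diaconis–Graham inequality

∀¬⊎greatest : ∀ {n} {P : Fin n → Set} → Decidable P →
              (∀ k → ¬ P k) ⊎ ∃[ a ] (P a × ∀ k → toℕ a < toℕ k → ¬ P k)
∀¬⊎greatest {zero} P? = inj₁ λ ()
∀¬⊎greatest {suc n} P? with ∀¬⊎greatest (P? ∘ suc)
... | inj₂ (a , Pa , none-above) = inj₂ (suc a , Pa , λ { (suc k) a<k → none-above k (s<s⁻¹ a<k) })
... | inj₁ none with P? zero
...   | yes P0 = inj₂ (zero , P0 , λ { (suc k) _ → none k })
...   | no ¬P0 = inj₁ λ { zero → ¬P0 ; (suc k) → none k }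

module _ {n : ℕ} (π : Permutation′ n) where

  private
    πₓ : Fin n → ℕ
    πₓ x = toℕ (π ⟨$⟩ʳ x)

  -- If π x < x, the cycle of x would have to leave {y | y < x}, which π y ≤ y forbids.
  non-exceeding⇒id : (∀ x → πₓ x ≤ toℕ x) → ∀ x → π ⟨$⟩ʳ x ≡ x
  non-exceeding⇒id πx≤x x with π ⟨$⟩ʳ x ≟ x
  ... | yes πx≡x = πx≡x
  ... | no πx≢x =
    let z , z<x , πz≮x = Orbit.escape π (λ y → toℕ y <? toℕ x) πx<x (<-irrefl refl)
    in contradiction (≤-<-trans (πx≤x z) z<x) πz≮x
    where
    πx<x : πₓ x < toℕ x
    πx<x = ≤∧≢⇒< (πx≤x x) (πx≢x ∘ toℕ-injective)

  -- For the last a with a < π a, the cycle of π a must leave (a, π a]; it does so at some b with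
  -- π b ≤ a, since π b ≤ b ≤ π a beyond a.
  id⊎reducing : (∀ x → π ⟨$⟩ʳ x ≡ x) ⊎ ∃[ a ] ∃[ b ] Reducing π a b
  id⊎reducing with ∀¬⊎greatest (λ x → toℕ x <? πₓ x)
  ... | inj₁ none = inj₁ (non-exceeding⇒id (λ x → ≮⇒≥ (none x)))
  ... | inj₂ (a , a<πa , none-above) =
    let b , (a<b , b≤πa) , πb∉ = Orbit.escape π S? (a<πa , ≤-refl) (λ (a<a , _) → <-irrefl refl a<a)
        πb≤a = ≮⇒≥ (λ a<πb → πb∉ (a<πb , ≤-trans (≮⇒≥ (none-above b a<b)) b≤πa))
    in inj₂ (a , b , reducing πb≤a a<b b≤πa)
    where
    S? : Decidable (λ y → toℕ a < toℕ y × toℕ y ≤ πₓ a)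
    S? y = (toℕ a <? toℕ y) ×-dec (toℕ y ≤? πₓ a)

  module _ (id : ∀ x → π ⟨$⟩ʳ x ≡ x) where

    I-id : I π ≡ 0
    I-id = trans (I-∑ π) (∑-zero λ i → ∑-zero λ j → 𝟙-false λ inv →
      let i<j , πj<πi = ∧-<ᵇ⁻ {toℕ i} {toℕ j} {πₓ j} {πₓ i} inv
      in <-asym i<j (toℕ-<-cong (sym (id j)) (sym (id i)) πj<πi))

    iter-id : ∀ k x → iter π k x ≡ x
    iter-id zero x = refl
    iter-id (suc k) x = trans (cong (π ⟨$⟩ʳ_) (iter-id k x)) (id x)

    T-id : T π ≡ 0
    T-id = trans (cong (n ∸_) cyc≡n) (n∸n≡0 n)
      where
      cyc≡n : cyc π ≡ n
      cyc≡n = trans (cyc-∑ π) (trans (sum-cong-≗ λ x → 𝟙-true (Orbit.CycleMin⇒isCycleMin π λ where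
                (k , refl) → ≤-reflexive (cong toℕ (sym (iter-id k x))))) (∑-1 n))

I+T≤D : ∀ {n} (π : Permutation′ n) → I π + T π ≤ D π
I+T≤D π = go π (<-wellFounded (D π))
  where
  go : ∀ {n} (π : Permutation′ n) → Acc _<_ (D π) → I π + T π ≤ D π
  go π (acc smaller) with id⊎reducing π
  ... | inj₁ id = subst (_≤ D π) (sym (cong₂ _+_ (I-id π id) (T-id π id))) z≤n
  ... | inj₂ (a , b , red) = begin
    I π + T π                                      ≤⟨ I+T-swapAt red ⟩
    I π′ + T π′ + (c + c)                          ≤⟨ +-monoˡ-≤ (c + c) (go π′ (smaller (D-swapAt-< red))) ⟩
    D π′ + (c + c)                                 ≡⟨ D-swapAt red ⟨
    D π                                            ∎
    where
    open ≤-Reasoning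
    π′ = swapAt a b π
    c = toℕ b ∸ toℕ a

module _ {n : ℕ} {π : Permutation′ n} (shallow : Shallow π) {a b : Fin n} (red : Reducing π a b) where

  private
    π′ = swapAt a b π
    c = toℕ b ∸ toℕ a

  Shallow-swapAt : Shallow π′
  Shallow-swapAt = ≤-antisym (I+T≤D π′) (+-cancelʳ-≤ (c + c) (D π′) (I π′ + T π′) (begin
    D π′ + (c + c)          ≡⟨ D-swapAt red ⟨
    D π                     ≡⟨ shallow ⟨
    I π + T π               ≤⟨ I+T-swapAt red ⟩
    I π′ + T π′ + (c + c)   ∎))
    where open ≤-Reasoning

  Shallow⇒values-between : ∀ k → toℕ a < toℕ k → toℕ k < toℕ b →
                              toℕ (π ⟨$⟩ʳ b) ≤ toℕ (π ⟨$⟩ʳ k) × toℕ (π ⟨$⟩ʳ k) ≤ toℕ (π ⟨$⟩ʳ a)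
  Shallow⇒values-between k a<k k<b = ≮⇒≥ (outside ∘ inj₂) , ≮⇒≥ (outside ∘ inj₁)
    where
    open ≤-Reasoning
    outside : toℕ (π ⟨$⟩ʳ a) < toℕ (π ⟨$⟩ʳ k) ⊎ toℕ (π ⟨$⟩ʳ k) < toℕ (π ⟨$⟩ʳ b) → ⊥
    outside πk-outside = <-irrefl refl (begin-strict
      I π + T π                <⟨ I+T-swapAt-between red k a<k k<b πk-outside ⟩
      I π′ + T π′ + (c + c)    ≤⟨ +-monoˡ-≤ (c + c) (I+T≤D π′) ⟩
      D π′ + (c + c)           ≡⟨ D-swapAt red ⟨
      D π                      ≡⟨ shallow ⟨
      I π + T π                ∎)

-- Extremal 3412 patterns

-- An occurrence r < i < j < s of 3412 whose 4 is the largest value and whose 1 is the smallest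
-- (values are 0-based, so these are n ∸ 1 and 0).
record Extremal3412 {n} (π : Permutation′ n) : Set where
  constructor extremal3412
  field
    r i j s : Fin n
    r<i : toℕ r < toℕ i
    i<j : toℕ i < toℕ j
    j<s : toℕ j < toℕ s
    πi≡max : toℕ (π ⟨$⟩ʳ i) ≡ n ∸ 1
    πj≡0 : toℕ (π ⟨$⟩ʳ j) ≡ 0
    πs<πr : toℕ (π ⟨$⟩ʳ s) < toℕ (π ⟨$⟩ʳ r)

  width : ℕ
  width = toℕ j ∸ toℕ i

module _ {n : ℕ} {π : Permutation′ n} (p : Extremal3412 π) where

  open Extremal3412 {n} {π} p

  private
    πₓ : Fin n → ℕ
    πₓ x = toℕ (π ⟨$⟩ʳ x)

  ≤max : ∀ (x : Fin n) → toℕ x ≤ πₓ i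
  ≤max x = subst (toℕ x ≤_) (sym πi≡max) (toℕ≤pred[n] x)

  min≤ : ∀ (x : Fin n) → πₓ j ≤ toℕ x
  min≤ x = subst (_≤ toℕ x) (sym πj≡0) z≤n

  below-max : ∀ {x} → x ≢ i → πₓ x < πₓ i
  below-max x≢i = ≤∧≢⇒< (≤max (π ⟨$⟩ʳ _)) (x≢i ∘ ⟨$⟩ʳ-injective π ∘ toℕ-injective)

  above-min : ∀ {x} → x ≢ j → πₓ j < πₓ x
  above-min x≢j = ≤∧≢⇒< (min≤ (π ⟨$⟩ʳ _)) (x≢j ∘ sym ∘ ⟨$⟩ʳ-injective π ∘ toℕ-injective)

  move-max-right : ∀ k → toℕ i < toℕ k → toℕ k < toℕ j → Extremal3412 (swapAt i k π)
  move-max-right k i<k k<j = extremal3412 r k j s (<-trans r<i i<k) k<j j<s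
    (trans (cong toℕ (swapAt-matchʳ π {i} {k})) πi≡max)
    (trans (cong toℕ (swapAt-outside π i<k (inj₂ k<j))) πj≡0)
    (toℕ-<-cong (swapAt-outside π i<k (inj₂ (<-trans k<j j<s))) (swapAt-outside π i<k (inj₁ r<i)) πs<πr)

  move-min-left : ∀ k → toℕ i < toℕ k → toℕ k < toℕ j → Extremal3412 (swapAt k j π)
  move-min-left k i<k k<j = extremal3412 r i k s r<i i<k (<-trans k<j j<s)
    (trans (cong toℕ (swapAt-outside π k<j (inj₁ i<k))) πi≡max)
    (trans (cong toℕ (swapAt-matchˡ π {k} {j})) πj≡0)
    (toℕ-<-cong (swapAt-outside π k<j (inj₂ j<s)) (swapAt-outside π k<j (inj₁ (<-trans r<i i<k))) πs<πr)

Shallow⇒no-extremal3412 : ∀ {n} {π : Permutation′ n} → Shallow π → ¬ Extremal3412 π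
Shallow⇒no-extremal3412 shallow p = descend shallow p (<-wellFounded (Extremal3412.width p))
  where
  descend : ∀ {n} {π : Permutation′ n} → Shallow π → (p : Extremal3412 π) → Acc _<_ (Extremal3412.width p) → ⊥
  descend {n} {π} shallow p@(extremal3412 r i j s r<i i<j j<s _ _ πs<πr) (acc narrower)
    with toℕ j ≤? πₓ r | πₓ s ≤? toℕ i
    where
    πₓ : Fin n → ℕ
    πₓ x = toℕ (π ⟨$⟩ʳ x)
  ... | yes j≤πr | _ = <⇒≱ (below-max p (Finₚ.<⇒≢ r<i))
    (proj₂ (Shallow⇒values-between shallow (reducing (min≤ p r) (<-trans r<i i<j) j≤πr) i r<i i<j))
  ... | no _ | yes πs≤i = <⇒≱ (above-min p (≢-sym (Finₚ.<⇒≢ j<s)))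
    (proj₁ (Shallow⇒values-between shallow (reducing πs≤i (<-trans i<j j<s) (≤max p s)) j i<j j<s))
  ... | no j≰πr | no πs≰i
    with Orbit.escape π S? (<-trans (≰⇒> πs≰i) πs<πr , ≰⇒> j≰πr) (λ (i<r , _) → <-asym r<i i<r)
    where
    S? : Decidable (λ y → toℕ i < toℕ y × toℕ y < toℕ j)
    S? y = (toℕ i <? toℕ y) ×-dec (toℕ y <? toℕ j)
  ...   | k , (i<k , k<j) , πk∉S with toℕ (π ⟨$⟩ʳ k) ≤? toℕ i
  ...     | yes πk≤i = descend (Shallow-swapAt shallow (reducing πk≤i i<k (≤max p k)))
                               (move-max-right p k i<k k<j) (narrower (∸-monoʳ-< i<k (<⇒≤ k<j)))
  ...     | no πk≰i = descend (Shallow-swapAt shallow (reducing (min≤ p k) k<j j≤πk))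
                              (move-min-left p k i<k k<j) (narrower (∸-monoˡ-< k<j (<⇒≤ i<k)))
    where
    j≤πk : toℕ j ≤ toℕ (π ⟨$⟩ʳ k)
    j≤πk = ≮⇒≥ (λ πk<j → πk∉S (≰⇒> πk≰i , πk<j))

theorem2p8 : (n : ℕ) (π : Permutation′ n) → Shallow π →
    (¬ (∃[ r ] ∃[ i ] ∃[ j ] ∃[ s ]
          (toℕ r < toℕ i × toℕ i < toℕ j × toℕ j < toℕ s
           × toℕ (π ⟨$⟩ʳ i) ≡ n ∸ 1 × toℕ (π ⟨$⟩ʳ j) ≡ 0
           × toℕ (π ⟨$⟩ʳ s) < toℕ (π ⟨$⟩ʳ r))))
    × (¬ (∃[ f ] ∃[ l ] ∃[ i ] ∃[ j ]
          (toℕ f ≡ 0 × toℕ l ≡ n ∸ 1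
           × toℕ f < toℕ i × toℕ i < toℕ j × toℕ j < toℕ l
           × toℕ (π ⟨$⟩ʳ j) < toℕ (π ⟨$⟩ʳ l)
           × toℕ (π ⟨$⟩ʳ l) < toℕ (π ⟨$⟩ʳ f)
           × toℕ (π ⟨$⟩ʳ f) < toℕ (π ⟨$⟩ʳ i))))
theorem2p8 n π shallow =
  (λ (r , i , j , s , r<i , i<j , j<s , πi≡max , πj≡0 , πs<πr) →
     Shallow⇒no-extremal3412 shallow (extremal3412 r i j s r<i i<j j<s πi≡max πj≡0 πs<πr)) ,
  (λ (f , l , i , j , f≡0 , l≡max , _ , i<j , _ , πj<πl , πl<πf , πf<πi) →
     Shallow⇒no-extremal3412 (Shallow-flip π shallow)
       (extremal3412 (π ⟨$⟩ʳ j) (π ⟨$⟩ʳ l) (π ⟨$⟩ʳ f) (π ⟨$⟩ʳ i) πj<πl πl<πf πf<πi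
         (trans (cong toℕ (inverseˡ π)) l≡max) (trans (cong toℕ (inverseˡ π)) f≡0)
         (toℕ-<-cong (inverseˡ π) (inverseˡ π) i<j)))
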